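{- For every integer $k \geq 2$, the automorphism group $\operatorname{Aut}(C_{2k})$ of the cycle $C_{2k}$ on $2k$ vertices is properly contained in its endomorphism monoid $\operatorname{End}(C_{2k})$, and $D(C_{2k}) = D_e(C_{2k})$.
   Context: Graphs are simple (no loops). An endomorphism of a graph $G=(V,E)$ is a map $\phi: V \to V$ such that for every edge $uv \in E$, $\phi(u)\phi(v)$ is an edge; $\operatorname{End}(G)$ is the monoid of endomorphisms and $\operatorname{Aut}(G)$ the group of automorphisms. A labeling (coloring) $c$ of $V$ is preserved by a map $\phi$ if $c(\phi(v)) = c(v)$ for all $v \in V$. The distinguishing number $D(G)$ is the least cardinal $d$ such that $G$ has a labeling with $d$ labels preserved only by the identity automorphism. The endomorphism distinguishing number $D_e(G)$ is the least cardinal $d$ such that $G$ has a labeling with $d$ labels preserved only by the identity endomorphism. -}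

module Defs where

open import Data.Nat using (ℕ; zero; suc; _+_; _<_)
open import Data.Fin using (Fin; toℕ)
open import Data.Product using (Σ; _×_; ∃)
open import Data.Sum using (_⊎_)
open import Relation.Binary.PropositionalEquality using (_≡_)
open import Relation.Nullary using (¬_)
open import Function.Definitions using (Bijective)

record Graph : Set₁ where
  field
    n   : ℕ
    Adj : Fin n → Fin n → Set
open Graph public

CycSucc : (n : ℕ) → Fin n → Fin n → Set
CycSucc n i j = (toℕ j ≡ suc (toℕ i)) ⊎ ((suc (toℕ i) ≡ n) × (toℕ j ≡ 0))

Cycle : ℕ → Graph
Cycle m = record { n = m ; Adj = λ i j → CycSucc m i j ⊎ CycSucc m j i }

module _ (G : Graph) where
  V : Set
  V = Fin (n G)

  IsEnd : (V → V) → Set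
  IsEnd φ = ∀ u v → Adj G u v → Adj G (φ u) (φ v)

  IsAut : (V → V) → Set
  IsAut φ = Bijective _≡_ _≡_ φ × (∀ u v → (Adj G u v → Adj G (φ u) (φ v)) × (Adj G (φ u) (φ v) → Adj G u v))

  IsIdentity : (V → V) → Set
  IsIdentity φ = ∀ v → φ v ≡ v

  Preserves : {L : Set} → (V → L) → (V → V) → Set
  Preserves c φ = ∀ v → c (φ v) ≡ c v

  Distinguishing : ℕ → Set
  Distinguishing d = Σ (V → Fin d) λ c → ∀ φ → IsAut φ → Preserves c φ → IsIdentity φ

  EndDistinguishing : ℕ → Set
  EndDistinguishing d = Σ (V → Fin d) λ c → ∀ φ → IsEnd φ → Preserves c φ → IsIdentity φ

  IsDistNumber : ℕ → Set
  IsDistNumber d = Distinguishing d × (∀ d′ → d′ < d → ¬ Distinguishing d′)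

  IsEndDistNumber : ℕ → Set
  IsEndDistNumber d = EndDistinguishing d × (∀ d′ → d′ < d → ¬ EndDistinguishing d′)

  AutProperlyInEnd : Set
  AutProperlyInEnd = (∀ φ → IsAut φ → IsEnd φ) × Σ (V → V) λ φ → IsEnd φ × ¬ IsAut φ

-- An endomorphism-distinguishing labeling is in particular distinguishing, so D ≤ Dₑ, and it
-- suffices to give an endomorphism-distinguishing labeling with D(C₂ₖ) labels. Folding C₂ₖ onto
-- an edge by parity is an endomorphism that is not injective, so Aut ⊂ End.
--
-- For C₄, every 2-labeling is preserved by one of the four reflections, while the labeling
-- 0,0,1,2 is preserved by no endomorphism but the identity: D = Dₑ = 3.
--
-- For 2k ≥ 6 the reflection i ↦ 2k−1−i shows D ≥ 2. Colour 0, 1 and 3 black and the rest white.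
-- An endomorphism φ preserving this labeling maps the edge 01 to the only black edge, so it fixes
-- or swaps 0 and 1. Read φ(0), …, φ(2k−1) as numbers: away from 0 they change by at most one per
-- step. If φ fixes 0 and 1, then φ(2) = 2 and φ(2k−1) = 2k−1 pin the walk down to φ(j) = j. If φ
-- swaps them, then φ(4) = 2k−1 and φ(2k−1) = 2, which a walk through white vertices cannot
-- achieve in 2k−5 steps. Hence D = Dₑ = 2.
module Submission where

open import Defs
open import Data.Nat using (ℕ; zero; suc; _+_; _∸_; _≤_; _<_; _≤′_; ≤′-refl; ≤′-step; z≤n; s≤s; parity)
open import Data.Nat.Properties
open import Data.Nat.DivMod using (_mod_; m<n⇒m%n≡m)
open import Data.Fin as Fin using (Fin; zero; suc; toℕ; opposite; inject≤; #_)
open import Data.Fin.Properties using (toℕ-injective; toℕ<n; toℕ-fromℕ<; opposite-prop; opposite-involutive; inject≤-injective; all?)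
open import Data.Parity using (Parity; 0ℙ; 1ℙ; _⁻¹)
open import Data.Parity.Properties using (⁻¹-selfInverse; suc-homo-⁻¹; +-homo-+; p+p≡0ℙ)
open import Data.Product using (Σ; _×_; _,_; proj₁; proj₂)
open import Data.Sum using (_⊎_; inj₁; inj₂; swap)
open import Data.Empty using (⊥; ⊥-elim)
open import Function using (_∘_)
open import Relation.Nullary using (¬_; Dec; yes; no; contradiction)
open import Relation.Nullary.Decidable using (_⊎-dec_; _×-dec_; _→-dec_; True; toWitness)
open import Relation.Binary.PropositionalEquality

module _ (G : Graph) where

  aut⇒end : ∀ φ → IsAut G φ → IsEnd G φ
  aut⇒end φ (_ , adj) u v = proj₁ (adj u v)

  involutive-end⇒aut : ∀ φ → (∀ v → φ (φ v) ≡ v) → IsEnd G φ → IsAut G φ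
  involutive-end⇒aut φ invol end = (injective , surjective) , λ u v → end u v , reflect u v
    where
    injective : ∀ {x y} → φ x ≡ φ y → x ≡ y
    injective {x} {y} eq = trans (sym (invol x)) (trans (cong φ eq) (invol y))
    surjective : ∀ y → Σ (V G) λ x → ∀ {z} → z ≡ x → φ z ≡ y
    surjective y = φ y , λ z≡φy → trans (cong φ z≡φy) (invol y)
    reflect : ∀ u v → Adj G (φ u) (φ v) → Adj G u v
    reflect u v adj = subst₂ (Adj G) (invol u) (invol v) (end (φ u) (φ v) adj)

  distinguishing-mono : ∀ {d d′} → d′ ≤ d → Distinguishing G d′ → Distinguishing G d
  distinguishing-mono d′≤d (c , c-dist) =
    (λ v → inject≤ (c v) d′≤d) ,
    λ φ aut pres → c-dist φ aut λ v → inject≤-injective d′≤d d′≤d (c (φ v)) (c v) (pres v)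

  endDistinguishing⇒distinguishing : ∀ {d} → EndDistinguishing G d → Distinguishing G d
  endDistinguishing⇒distinguishing (c , c-dist) = c , λ φ aut → c-dist φ (aut⇒end φ aut)

  NontrivialSymmetry : {L : Set} → (V G → L) → Set
  NontrivialSymmetry c = Σ (V G → V G) λ φ → IsAut G φ × Preserves G c φ × ¬ IsIdentity G φ

  symmetric⇒¬distinguishing : ∀ {d} → (∀ (c : V G → Fin d) → NontrivialSymmetry c) → ¬ Distinguishing G d
  symmetric⇒¬distinguishing symmetric (c , c-dist) with symmetric c
  ... | φ , aut , pres , nontrivial = nontrivial (c-dist φ aut pres)

  D≡Dₑ : ∀ d → EndDistinguishing G (suc d) → ¬ Distinguishing G d →
         IsDistNumber G (suc d) × IsEndDistNumber G (suc d)
  D≡Dₑ d end-dist ¬dist =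
    (endDistinguishing⇒distinguishing end-dist , fewer-labels-fail) ,
    (end-dist , λ d′ d′<1+d → fewer-labels-fail d′ d′<1+d ∘ endDistinguishing⇒distinguishing)
    where
    fewer-labels-fail : ∀ d′ → d′ < suc d → ¬ Distinguishing G d′
    fewer-labels-fail d′ d′<1+d dist = ¬dist (distinguishing-mono (≤-pred d′<1+d) dist)

  ProperTwoColouring : (V G → Parity) → Set
  ProperTwoColouring c = ∀ u v → Adj G u v → c v ≡ c u ⁻¹

  foldOnto : V G → V G → Parity → V G
  foldOnto x y 0ℙ = x
  foldOnto x y 1ℙ = y

  bipartite⇒aut⊂end : ∀ {x y u w} → Adj G x y → Adj G y x → (c : V G → Parity) → ProperTwoColouring c →
                      u ≢ w → c u ≡ c w → AutProperlyInEnd G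
  bipartite⇒aut⊂end {x} {y} {u} {w} xy yx c proper u≢w cu≡cw =
    aut⇒end , fold , fold-end , λ ((injective , _) , _) → u≢w (injective (cong (foldOnto x y) cu≡cw))
    where
    fold : V G → V G
    fold v = foldOnto x y (c v)
    fold-end : IsEnd G fold
    fold-end s t st with c s | c t | proper s t st
    ... | 0ℙ | 1ℙ | _ = xy
    ... | 1ℙ | 0ℙ | _ = yx

-- Adj (Cycle N) u v unfolds to Adjℕ N (toℕ u) (toℕ v).
Succℕ : ℕ → ℕ → ℕ → Set
Succℕ N x y = (y ≡ suc x) ⊎ ((suc x ≡ N) × (y ≡ 0))

Adjℕ : ℕ → ℕ → ℕ → Set
Adjℕ N x y = Succℕ N x y ⊎ Succℕ N y x

module _ {N : ℕ} where

  neighbours-of-0 : ∀ {x} → Adjℕ N x 0 → x ≡ 1 ⊎ suc x ≡ N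
  neighbours-of-0 (inj₁ (inj₂ (1+x≡N , _))) = inj₂ 1+x≡N
  neighbours-of-0 (inj₂ (inj₁ x≡1)) = inj₁ x≡1
  neighbours-of-0 (inj₂ (inj₂ (1≡N , refl))) = inj₂ 1≡N

  neighbours-of-1 : ∀ {x} → Adjℕ N x 1 → x ≡ 0 ⊎ x ≡ 2
  neighbours-of-1 (inj₁ (inj₁ refl)) = inj₁ refl
  neighbours-of-1 (inj₂ (inj₁ x≡2)) = inj₂ x≡2
  neighbours-of-1 (inj₂ (inj₂ (_ , x≡0))) = inj₁ x≡0

  adjacent-nonzero⇒near : ∀ {x y} → Adjℕ N x y → x ≢ 0 → y ≢ 0 → y ≤ suc x × x ≤ suc y
  adjacent-nonzero⇒near {x} (inj₁ (inj₁ refl)) _ _ = ≤-refl , m≤n⇒m≤1+n (n≤1+n x)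
  adjacent-nonzero⇒near (inj₁ (inj₂ (_ , y≡0))) _ y≢0 = contradiction y≡0 y≢0
  adjacent-nonzero⇒near {y = y} (inj₂ (inj₁ refl)) _ _ = m≤n⇒m≤1+n (n≤1+n y) , ≤-refl
  adjacent-nonzero⇒near (inj₂ (inj₂ (_ , x≡0))) x≢0 _ = contradiction x≡0 x≢0

adjacent-below-last : ∀ {m x y} → Adjℕ (suc m) x y → x < m → y < m → y ≡ suc x ⊎ x ≡ suc y
adjacent-below-last (inj₁ (inj₁ y≡1+x)) _ _ = inj₁ y≡1+x
adjacent-below-last (inj₁ (inj₂ (refl , _))) x<m _ = contradiction x<m (<-irrefl refl)
adjacent-below-last (inj₂ (inj₁ x≡1+y)) _ _ = inj₂ x≡1+y
adjacent-below-last (inj₂ (inj₂ (refl , _))) _ y<m = contradiction y<m (<-irrefl refl)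

module _ (a : ℕ → ℕ) where

  rises-slowly : ∀ {i j} → i ≤ j → (∀ l → i ≤ l → l < j → a (suc l) ≤ suc (a l)) → a j + i ≤ a i + j
  rises-slowly i≤j = go (≤⇒≤′ i≤j)
    where
    open ≤-Reasoning
    go : ∀ {i j} → i ≤′ j → (∀ l → i ≤ l → l < j → a (suc l) ≤ suc (a l)) → a j + i ≤ a i + j
    go ≤′-refl _ = ≤-refl
    go {i} {suc j} (≤′-step i≤′j) rise = begin
      a (suc j) + i  ≤⟨ +-monoˡ-≤ i (rise j (≤′⇒≤ i≤′j) ≤-refl) ⟩
      suc (a j + i)  ≤⟨ s≤s (go i≤′j λ l i≤l l<j → rise l i≤l (m<n⇒m<1+n l<j)) ⟩
      suc (a i + j)  ≡⟨ +-suc (a i) j ⟨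
      a i + suc j    ∎

  falls-slowly : ∀ {i j} → i ≤ j → (∀ l → i ≤ l → l < j → a l ≤ suc (a (suc l))) → a i + i ≤ a j + j
  falls-slowly i≤j = go (≤⇒≤′ i≤j)
    where
    open ≤-Reasoning
    go : ∀ {i j} → i ≤′ j → (∀ l → i ≤ l → l < j → a l ≤ suc (a (suc l))) → a i + i ≤ a j + j
    go ≤′-refl _ = ≤-refl
    go {i} {suc j} (≤′-step i≤′j) fall = begin
      a i + i            ≤⟨ go i≤′j (λ l i≤l l<j → fall l i≤l (m<n⇒m<1+n l<j)) ⟩
      a j + j            ≤⟨ +-monoˡ-≤ j (fall j (≤′⇒≤ i≤′j) ≤-refl) ⟩
      suc (a (suc j)) + j ≡⟨ +-suc (a (suc j)) j ⟨
      a (suc j) + suc j  ∎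

black : ℕ → Fin 2
black 0 = # 1
black 1 = # 1
black 2 = # 0
black 3 = # 1
black (suc (suc (suc (suc _)))) = # 0

white-from-4 : ∀ {j} → 4 ≤ j → black j ≡ # 0
white-from-4 (s≤s (s≤s (s≤s (s≤s _)))) = refl

white⇒≢0 : ∀ {x} → black x ≡ # 0 → x ≢ 0
white⇒≢0 () refl

black⇒≤3 : ∀ x → black x ≡ # 1 → x ≤ 3
black⇒≤3 0 _ = z≤n
black⇒≤3 1 _ = s≤s z≤n
black⇒≤3 3 _ = ≤-refl
black⇒≤3 (suc (suc (suc (suc _)))) ()

black-successor : ∀ x → black x ≡ # 1 → black (suc x) ≡ # 1 → x ≡ 0
black-successor 0 _ _ = refl
black-successor 1 _ ()
black-successor 3 _ ()
black-successor (suc (suc (suc (suc _)))) () _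

black-edge : ∀ {m x y} → 4 ≤ m → Adjℕ (suc m) x y → black x ≡ # 1 → black y ≡ # 1 →
             (x ≡ 0 × y ≡ 1) ⊎ (x ≡ 1 × y ≡ 0)
black-edge {m} {x} {y} 4≤m adj x-black y-black =
  black-step (adjacent-below-last adj (below-m x x-black) (below-m y y-black))
  where
  below-m : ∀ z → black z ≡ # 1 → z < m
  below-m z z-black = <-≤-trans (s≤s (black⇒≤3 z z-black)) 4≤m
  black-step : y ≡ suc x ⊎ x ≡ suc y → (x ≡ 0 × y ≡ 1) ⊎ (x ≡ 1 × y ≡ 0)
  black-step (inj₁ refl) with refl ← black-successor x x-black y-black = inj₁ (refl , refl)
  black-step (inj₂ refl) with refl ← black-successor y y-black x-black = inj₂ (refl , refl)

module BlackWhiteClosedWalk {m : ℕ} (5≤m : 5 ≤ m) (a : ℕ → ℕ)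
  (step : ∀ j → j < m → Adjℕ (suc m) (a j) (a (suc j)))
  (wrap : Adjℕ (suc m) (a m) (a 0))
  (colour : ∀ j → j ≤ m → black (a j) ≡ black j) where

  private
    4≤m : 4 ≤ m
    4≤m = ≤-trans (n≤1+n 4) 5≤m

    m≢0 : m ≢ 0
    m≢0 refl = contradiction 5≤m λ ()

    j<m : ∀ j {j<5 : True (j <? 5)} → j < m
    j<m j {j<5} = <-≤-trans (toWitness j<5) 5≤m

    j≤m : ∀ j {j<5 : True (j <? 5)} → j ≤ m
    j≤m j {j<5} = <⇒≤ (j<m j {j<5})

  a≢0-from-4 : ∀ j → 4 ≤ j → j ≤ m → a j ≢ 0
  a≢0-from-4 j 4≤j j≤m = white⇒≢0 (trans (colour j j≤m) (white-from-4 4≤j))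

  colour-of : ∀ {j x} → j ≤ m → a j ≡ x → black x ≡ black j
  colour-of j≤m refl = colour _ j≤m

  module FixedStart (a0≡0 : a 0 ≡ 0) (a1≡1 : a 1 ≡ 1) where

    a2≡2 : a 2 ≡ 2
    a2≡2 with neighbours-of-1 (subst (Adjℕ _ (a 2)) a1≡1 (swap (step 1 (j<m 1))))
    ... | inj₁ a2≡0 = contradiction a2≡0 (white⇒≢0 (colour 2 (j≤m 2)))
    ... | inj₂ a2≡2 = a2≡2

    a≢0 : ∀ j → 2 ≤ j → j ≤ m → a j ≢ 0
    a≢0 1 (s≤s ())
    a≢0 2 _ _ = subst (_≢ 0) (sym a2≡2) λ ()
    a≢0 3 _ _ a3≡0 with neighbours-of-0 (subst₂ (Adjℕ _) a2≡2 a3≡0 (step 2 (j<m 2)))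
    ... | inj₂ 3≡1+m = contradiction (subst (5 ≤_) (suc-injective (sym 3≡1+m)) 5≤m) λ { (s≤s (s≤s ())) }
    a≢0 j@(suc (suc (suc (suc _)))) _ j≤m = a≢0-from-4 j (s≤s (s≤s (s≤s (s≤s z≤n)))) j≤m

    am≡m : a m ≡ m
    am≡m with neighbours-of-0 (subst (Adjℕ _ (a m)) a0≡0 wrap)
    ... | inj₁ am≡1 with () ← trans (colour-of ≤-refl am≡1) (white-from-4 4≤m)
    ... | inj₂ 1+am≡1+m = suc-injective 1+am≡1+m

    rises-from-2 : ∀ {i j} → 2 ≤ i → j ≤ m → ∀ l → i ≤ l → l < j → a (suc l) ≤ suc (a l)
    rises-from-2 2≤i j≤m l i≤l l<j = proj₁ (adjacent-nonzero⇒near (step l l<m)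
      (a≢0 l 2≤l (<⇒≤ l<m)) (a≢0 (suc l) (m≤n⇒m≤1+n 2≤l) l<m))
      where
      2≤l = ≤-trans 2≤i i≤l
      l<m = <-≤-trans l<j j≤m

    fixes : ∀ j → j ≤ m → a j ≡ j
    fixes 0 _ = a0≡0
    fixes 1 _ = a1≡1
    fixes j@(suc (suc _)) j≤m = ≤-antisym (+-cancelʳ-≤ 2 (a j) j below) (+-cancelˡ-≤ m j (a j) above)
      where
      open ≤-Reasoning
      2≤j : 2 ≤ j
      2≤j = s≤s (s≤s z≤n)
      below : a j + 2 ≤ j + 2
      below = begin
        a j + 2  ≤⟨ rises-slowly a 2≤j (rises-from-2 ≤-refl j≤m) ⟩
        a 2 + j  ≡⟨ cong (_+ j) a2≡2 ⟩
        2 + j    ≡⟨ +-comm 2 j ⟩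
        j + 2    ∎
      above : m + j ≤ m + a j
      above = begin
        m + j    ≡⟨ cong (_+ j) am≡m ⟨
        a m + j  ≤⟨ rises-slowly a j≤m (rises-from-2 2≤j ≤-refl) ⟩
        a j + m  ≡⟨ +-comm (a j) m ⟩
        m + a j  ∎

  module SwappedStart (a0≡1 : a 0 ≡ 1) (a1≡0 : a 1 ≡ 0) where

    a2≡m : a 2 ≡ m
    a2≡m with neighbours-of-0 (subst (Adjℕ _ (a 2)) a1≡0 (swap (step 1 (j<m 1))))
    ... | inj₁ a2≡1 with () ← colour-of (j≤m 2) a2≡1
    ... | inj₂ 1+a2≡1+m = suc-injective 1+a2≡1+m

    a3≡0 : a 3 ≡ 0
    a3≡0 with a 3 ≟ 0
    ... | yes a3≡0 = a3≡0
    ... | no a3≢0 = contradiction (≤-trans 5≤m m≤4) λ { (s≤s (s≤s (s≤s (s≤s ())))) }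
      where
      open ≤-Reasoning
      m≤4 : m ≤ 4
      m≤4 = begin
        m          ≡⟨ a2≡m ⟨
        a 2        ≤⟨ proj₂ (adjacent-nonzero⇒near (step 2 (j<m 2)) (subst (_≢ 0) (sym a2≡m) m≢0) a3≢0) ⟩
        suc (a 3)  ≤⟨ s≤s (black⇒≤3 (a 3) (colour 3 (j≤m 3))) ⟩
        4          ∎

    a4≡m : a 4 ≡ m
    a4≡m with neighbours-of-0 (subst (Adjℕ _ (a 4)) a3≡0 (swap (step 3 (j<m 3))))
    ... | inj₁ a4≡1 with () ← colour-of 4≤m a4≡1
    ... | inj₂ 1+a4≡1+m = suc-injective 1+a4≡1+m

    am≡2 : a m ≡ 2
    am≡2 with neighbours-of-1 (subst (Adjℕ _ (a m)) a0≡1 wrap)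
    ... | inj₁ am≡0 = contradiction am≡0 (a≢0-from-4 m 4≤m ≤-refl)
    ... | inj₂ am≡2 = am≡2

    impossible : ⊥
    impossible = contradiction (+-cancelˡ-≤ m 4 2 m+4≤m+2) λ { (s≤s (s≤s ())) }
      where
      open ≤-Reasoning
      falls : ∀ l → 4 ≤ l → l < m → a l ≤ suc (a (suc l))
      falls l 4≤l l<m = proj₂ (adjacent-nonzero⇒near (step l l<m)
        (a≢0-from-4 l 4≤l (<⇒≤ l<m)) (a≢0-from-4 (suc l) (m≤n⇒m≤1+n 4≤l) l<m))
      m+4≤m+2 : m + 4 ≤ m + 2
      m+4≤m+2 = begin
        m + 4    ≡⟨ cong (_+ 4) a4≡m ⟨
        a 4 + 4  ≤⟨ falls-slowly a 4≤m falls ⟩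
        a m + m  ≡⟨ cong (_+ m) am≡2 ⟩
        2 + m    ≡⟨ +-comm 2 m ⟩
        m + 2    ∎

  fixes : ∀ j → j ≤ m → a j ≡ j
  fixes with black-edge 4≤m (step 0 (j<m 0)) (colour 0 z≤n) (colour 1 (j≤m 1))
  ... | inj₁ (a0≡0 , a1≡1) = FixedStart.fixes a0≡0 a1≡1
  ... | inj₂ (a0≡1 , a1≡0) = ⊥-elim (SwappedStart.impossible a0≡1 a1≡0)

module _ {m : ℕ} where

  toℕ-mod : ∀ {j} → j < suc m → toℕ (j mod suc m) ≡ j
  toℕ-mod j<1+m = trans (toℕ-fromℕ< _) (m<n⇒m%n≡m j<1+m)

  toℕ-mod-toℕ : (v : Fin (suc m)) → toℕ v mod suc m ≡ v
  toℕ-mod-toℕ v = toℕ-injective (toℕ-mod (toℕ<n v))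

cycle-endDistinguishing₂ : ∀ N → 6 ≤ N → EndDistinguishing (Cycle N) 2
cycle-endDistinguishing₂ (suc m) (s≤s 5≤m) = black ∘ toℕ , preserved⇒identity
  where
  preserved⇒identity : ∀ φ → IsEnd (Cycle (suc m)) φ → Preserves (Cycle (suc m)) (black ∘ toℕ) φ →
                       IsIdentity (Cycle (suc m)) φ
  preserved⇒identity φ end pres v = toℕ-injective (begin
    toℕ (φ v)                  ≡⟨ cong (toℕ ∘ φ) (toℕ-mod-toℕ v) ⟨
    toℕ (φ (toℕ v mod suc m))  ≡⟨ BlackWhiteClosedWalk.fixes 5≤m a step wrap colour (toℕ v) (≤-pred (toℕ<n v)) ⟩
    toℕ v                      ∎)
    where
    open ≡-Reasoning
    a : ℕ → ℕ
    a j = toℕ (φ (j mod suc m))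
    step : ∀ j → j < m → Adjℕ (suc m) (a j) (a (suc j))
    step j j<m = end _ _ (inj₁ (inj₁ (trans (toℕ-mod (s≤s j<m)) (cong suc (sym (toℕ-mod (m<n⇒m<1+n j<m)))))))
    wrap : Adjℕ (suc m) (a m) (a 0)
    wrap = end _ _ (inj₁ (inj₂ (cong suc (toℕ-mod ≤-refl) , refl)))
    colour : ∀ j → j ≤ m → black (a j) ≡ black j
    colour j j≤m = trans (pres (j mod suc m)) (cong black (toℕ-mod (s≤s j≤m)))

opposite-reverses : ∀ {N} (i j : Fin N) → CycSucc N i j → CycSucc N (opposite j) (opposite i)
opposite-reverses {N} i j (inj₁ j≡1+i) = inj₁ (begin
  toℕ (opposite i)             ≡⟨ opposite-prop i ⟩
  N ∸ suc (toℕ i)              ≡⟨ +-∸-assoc 1 (subst (_< N) j≡1+i (toℕ<n j)) ⟩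
  suc (N ∸ suc (suc (toℕ i)))  ≡⟨ cong (λ t → suc (N ∸ suc t)) j≡1+i ⟨
  suc (N ∸ suc (toℕ j))        ≡⟨ cong suc (opposite-prop j) ⟨
  suc (toℕ (opposite j))       ∎)
  where open ≡-Reasoning
opposite-reverses {N} i j (inj₂ (1+i≡N , j≡0)) = inj₂ (opposite-j-last , opposite-i≡0)
  where
  open ≡-Reasoning
  opposite-j-last : suc (toℕ (opposite j)) ≡ N
  opposite-j-last = begin
    suc (toℕ (opposite j))  ≡⟨ cong suc (opposite-prop j) ⟩
    suc (N ∸ suc (toℕ j))   ≡⟨ cong (λ t → suc (N ∸ suc t)) j≡0 ⟩
    suc (N ∸ 1)             ≡⟨ cong (λ t → suc (t ∸ 1)) 1+i≡N ⟨
    suc (toℕ i)             ≡⟨ 1+i≡N ⟩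
    N                       ∎
  opposite-i≡0 : toℕ (opposite i) ≡ 0
  opposite-i≡0 = begin
    toℕ (opposite i)  ≡⟨ opposite-prop i ⟩
    N ∸ suc (toℕ i)   ≡⟨ cong (_∸ suc (toℕ i)) 1+i≡N ⟨
    suc (toℕ i) ∸ suc (toℕ i)  ≡⟨ n∸n≡0 (suc (toℕ i)) ⟩
    0                 ∎

opposite-aut : ∀ N → IsAut (Cycle N) opposite
opposite-aut N = involutive-end⇒aut (Cycle N) opposite opposite-involutive end
  where
  end : IsEnd (Cycle N) opposite
  end u v (inj₁ uv) = inj₂ (opposite-reverses u v uv)
  end u v (inj₂ vu) = inj₁ (opposite-reverses v u vu)

cycle-¬distinguishing₁ : ∀ N → 2 ≤ N → ¬ Distinguishing (Cycle N) 1
cycle-¬distinguishing₁ N (s≤s (s≤s _)) = symmetric⇒¬distinguishing (Cycle N) λ c →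
  opposite , opposite-aut N , (λ v → single-label (c (opposite v)) (c v)) , λ isId → contradiction (isId zero) λ ()
  where
  single-label : (x y : Fin 1) → x ≡ y
  single-label zero zero = refl

parity-suc : ∀ n → parity (suc n) ≡ parity n ⁻¹
parity-suc n = sym (⁻¹-selfInverse (suc-homo-⁻¹ n))

parity-double : ∀ k → parity (k + k) ≡ 0ℙ
parity-double k = trans (+-homo-+ k k) (p+p≡0ℙ (parity k))

cycle-aut⊂end : ∀ N → 3 ≤ N → parity N ≡ 0ℙ → AutProperlyInEnd (Cycle N)
cycle-aut⊂end N (s≤s (s≤s (s≤s _))) N-even =
  bipartite⇒aut⊂end (Cycle N) {# 0} {# 1} {# 0} {# 2} (inj₁ (inj₁ refl)) (inj₂ (inj₁ refl))
    (parity ∘ toℕ) proper (λ ()) refl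
  where
  open ≡-Reasoning
  proper-succ : ∀ i j → CycSucc N i j → parity (toℕ j) ≡ parity (toℕ i) ⁻¹
  proper-succ i j (inj₁ j≡1+i) = trans (cong parity j≡1+i) (parity-suc (toℕ i))
  proper-succ i j (inj₂ (1+i≡N , j≡0)) = begin
    parity (toℕ j)         ≡⟨ cong parity j≡0 ⟩
    0ℙ                     ≡⟨ N-even ⟨
    parity N               ≡⟨ cong parity 1+i≡N ⟨
    parity (suc (toℕ i))   ≡⟨ parity-suc (toℕ i) ⟩
    parity (toℕ i) ⁻¹      ∎
  proper : ProperTwoColouring (Cycle N) (parity ∘ toℕ)
  proper u v (inj₁ uv) = proper-succ u v uv
  proper u v (inj₂ vu) = sym (⁻¹-selfInverse (sym (proper-succ v u vu)))

pattern v₀ = zero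
pattern v₁ = suc zero
pattern v₂ = suc (suc zero)
pattern v₃ = suc (suc (suc zero))

C₄ : Graph
C₄ = Cycle 4

C₄-adjacent? : (u v : Fin 4) → Dec (Adj C₄ u v)
C₄-adjacent? u v = succ? u v ⊎-dec succ? v u
  where
  succ? : (i j : Fin 4) → Dec (CycSucc 4 i j)
  succ? i j = (toℕ j ≟ suc (toℕ i)) ⊎-dec ((suc (toℕ i) ≟ 4) ×-dec (toℕ j ≟ 0))

C₄-aut : (φ : Fin 4 → Fin 4) →
         {True (all? λ v → φ (φ v) Fin.≟ v)} →
         {True (all? λ u → all? λ v → C₄-adjacent? u v →-dec C₄-adjacent? (φ u) (φ v))} →
         IsAut C₄ φ
C₄-aut φ {involutive} {end} = involutive-end⇒aut C₄ φ (toWitness involutive) (toWitness end)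

reflection : ℕ → Fin 4 → Fin 4
reflection s v = (s + 4 ∸ toℕ v) mod 4

x≢z∧y≢z⇒x≡y : (x y z : Fin 2) → x ≢ z → y ≢ z → x ≡ y
x≢z∧y≢z⇒x≡y zero zero _ _ _ = refl
x≢z∧y≢z⇒x≡y (suc zero) (suc zero) _ _ _ = refl
x≢z∧y≢z⇒x≡y zero (suc zero) zero x≢z _ = contradiction refl x≢z
x≢z∧y≢z⇒x≡y zero (suc zero) (suc zero) _ y≢z = contradiction refl y≢z
x≢z∧y≢z⇒x≡y (suc zero) zero zero _ y≢z = contradiction refl y≢z
x≢z∧y≢z⇒x≡y (suc zero) zero (suc zero) x≢z _ = contradiction refl x≢z

C₄-symmetric : (c : Fin 4 → Fin 2) → NontrivialSymmetry C₄ c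
C₄-symmetric c with c v₁ Fin.≟ c v₃
... | yes c₁≡c₃ = reflection 0 , C₄-aut (reflection 0) ,
  (λ { v₀ → refl ; v₁ → sym c₁≡c₃ ; v₂ → refl ; v₃ → c₁≡c₃ }) , λ isId → contradiction (isId v₁) λ ()
... | no c₁≢c₃ with c v₀ Fin.≟ c v₂
... | yes c₀≡c₂ = reflection 2 , C₄-aut (reflection 2) ,
  (λ { v₀ → sym c₀≡c₂ ; v₁ → refl ; v₂ → c₀≡c₂ ; v₃ → refl }) , λ isId → contradiction (isId v₀) λ ()
... | no c₀≢c₂ with c v₀ Fin.≟ c v₁
... | yes c₀≡c₁ = reflection 1 , C₄-aut (reflection 1) ,
  (λ { v₀ → sym c₀≡c₁ ; v₁ → c₀≡c₁ ; v₂ → sym c₂≡c₃ ; v₃ → c₂≡c₃ }) , λ isId → contradiction (isId v₀) λ ()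
  where
  c₂≡c₃ : c v₂ ≡ c v₃
  c₂≡c₃ = x≢z∧y≢z⇒x≡y (c v₂) (c v₃) (c v₁) (c₀≢c₂ ∘ trans c₀≡c₁ ∘ sym) (c₁≢c₃ ∘ sym)
... | no c₀≢c₁ = reflection 3 , C₄-aut (reflection 3) ,
  (λ { v₀ → sym c₀≡c₃ ; v₁ → sym c₁≡c₂ ; v₂ → c₁≡c₂ ; v₃ → c₀≡c₃ }) , λ isId → contradiction (isId v₀) λ ()
  where
  c₀≡c₃ : c v₀ ≡ c v₃
  c₀≡c₃ = x≢z∧y≢z⇒x≡y (c v₀) (c v₃) (c v₁) c₀≢c₁ (c₁≢c₃ ∘ sym)
  c₁≡c₂ : c v₁ ≡ c v₂
  c₁≡c₂ = x≢z∧y≢z⇒x≡y (c v₁) (c v₂) (c v₀) (c₀≢c₁ ∘ sym) (c₀≢c₂ ∘ sym)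

C₄-label : Fin 4 → Fin 3
C₄-label v₀ = # 0
C₄-label v₁ = # 0
C₄-label v₂ = # 1
C₄-label v₃ = # 2

C₄-endDistinguishing : EndDistinguishing C₄ 3
C₄-endDistinguishing = C₄-label , preserved⇒identity
  where
  preserved⇒identity : ∀ φ → IsEnd C₄ φ → Preserves C₄ C₄-label φ → IsIdentity C₄ φ
  preserved⇒identity φ end pres = fixed
    where
    only-v₂ : ∀ x → C₄-label x ≡ C₄-label v₂ → x ≡ v₂
    only-v₂ = toWitness {a? = all? λ x → (C₄-label x Fin.≟ C₄-label v₂) →-dec (x Fin.≟ v₂)} _
    only-v₃ : ∀ x → C₄-label x ≡ C₄-label v₃ → x ≡ v₃
    only-v₃ = toWitness {a? = all? λ x → (C₄-label x Fin.≟ C₄-label v₃) →-dec (x Fin.≟ v₃)} _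
    only-v₁ : ∀ x → C₄-label x ≡ C₄-label v₁ → Adj C₄ x v₂ → x ≡ v₁
    only-v₁ = toWitness {a? = all? λ x → (C₄-label x Fin.≟ C₄-label v₁) →-dec (C₄-adjacent? x v₂ →-dec (x Fin.≟ v₁))} _
    only-v₀ : ∀ x → C₄-label x ≡ C₄-label v₀ → Adj C₄ x v₃ → x ≡ v₀
    only-v₀ = toWitness {a? = all? λ x → (C₄-label x Fin.≟ C₄-label v₀) →-dec (C₄-adjacent? x v₃ →-dec (x Fin.≟ v₀))} _
    φ₂ : φ v₂ ≡ v₂
    φ₂ = only-v₂ (φ v₂) (pres v₂)
    φ₃ : φ v₃ ≡ v₃
    φ₃ = only-v₃ (φ v₃) (pres v₃)
    fixed : IsIdentity C₄ φ
    fixed v₀ = only-v₀ (φ v₀) (pres v₀) (subst (Adj C₄ (φ v₀)) φ₃ (end v₀ v₃ (inj₂ (inj₂ (refl , refl)))))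
    fixed v₁ = only-v₁ (φ v₁) (pres v₁) (subst (Adj C₄ (φ v₁)) φ₂ (end v₁ v₂ (inj₁ (inj₁ refl))))
    fixed v₂ = φ₂
    fixed v₃ = φ₃

cycle-D≡Dₑ : ∀ k → 2 ≤ k → Σ ℕ λ d → IsDistNumber (Cycle (k + k)) d × IsEndDistNumber (Cycle (k + k)) d
cycle-D≡Dₑ 1 (s≤s ())
cycle-D≡Dₑ 2 _ = 3 , D≡Dₑ C₄ 2 C₄-endDistinguishing (symmetric⇒¬distinguishing C₄ C₄-symmetric)
cycle-D≡Dₑ k@(suc (suc (suc _))) _ =
  2 , D≡Dₑ (Cycle (k + k)) 1 (cycle-endDistinguishing₂ (k + k) 6≤k+k) (cycle-¬distinguishing₁ (k + k) (≤-trans (s≤s (s≤s z≤n)) 6≤k+k))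
  where
  6≤k+k : 6 ≤ k + k
  6≤k+k = +-mono-≤ {3} (s≤s (s≤s (s≤s z≤n))) (s≤s (s≤s (s≤s z≤n)))

lemma1 : (k : ℕ) → 2 ≤ k →
    AutProperlyInEnd (Cycle (k + k)) ×
    Σ ℕ (λ d → IsDistNumber (Cycle (k + k)) d × IsEndDistNumber (Cycle (k + k)) d)
lemma1 k 2≤k = cycle-aut⊂end (k + k) (≤-trans (n≤1+n 3) (+-mono-≤ 2≤k 2≤k)) (parity-double k) , cycle-D≡Dₑ k 2≤k
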